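{- For all terms $t,u$ and every variable $x$, $t[x/u]\to_{j}^{+} t\{x/u\}$. Moreover, if $|t|_x\ge 1$ then $t[x/u]\to_{d,c}^{+} t\{x/u\}$.
   Context: Terms are generated by $t,u ::= x \mid \lambda x.t \mid t\,u \mid t[x/u]$; $[x/u]$ is a jump, and $\lambda x.t$ and $t[x/u]$ bind $x$ in $t$ (not in $u$), terms taken modulo $\alpha$-conversion. $|t|_x$ is the number of free occurrences of $x$ in $t$, $t\{x/u\}$ capture-avoiding meta-level substitution. When $|t|_x\ge2$, $t_{[y]_x}$ denotes any term obtained from $t$ by renaming $i$ free occurrences of $x$ into a fresh variable $y$, $1\le i\le|t|_x-1$. Rules: (w) $t[x/u]\mapsto t$ if $|t|_x=0$; (d) $t[x/u]\mapsto t\{x/u\}$ if $|t|_x=1$; (c) $t[x/u]\mapsto t_{[y]_x}[x/u][y/u]$ if $|t|_x>1$, $y$ fresh. $\to_j$ is the contextual closure of (w),(d),(c), $\to_{d,c}$ that of (d),(c); $\to^+$ denotes transitive closure. -}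

module Defs where

open import Data.Nat using (ℕ; zero; suc; _+_; _≤_; _<_)
open import Data.Fin using (Fin; zero; suc)
open import Relation.Binary.PropositionalEquality using (_≡_)
open import Relation.Binary.Construct.Closure.Transitive using (TransClosure)
import Data.Fin
import Relation.Nullary

-- Terms modulo α-conversion, as well-scoped de Bruijn terms with n free variables.
-- λ x.t  binds index 0 in t;  t[x/u] (jump) binds index 0 in t, not in u.
data Tm (n : ℕ) : Set where
  var  : Fin n → Tm n
  lam  : Tm (suc n) → Tm n
  app  : Tm n → Tm n → Tm n
  jmp  : Tm (suc n) → Tm n → Tm n

ext : ∀ {m n} → (Fin m → Fin n) → Fin (suc m) → Fin (suc n)
ext ρ zero    = zero
ext ρ (suc i) = suc (ρ i)

ren : ∀ {m n} → (Fin m → Fin n) → Tm m → Tm n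
ren ρ (var i)   = var (ρ i)
ren ρ (lam t)   = lam (ren (ext ρ) t)
ren ρ (app t u) = app (ren ρ t) (ren ρ u)
ren ρ (jmp t u) = jmp (ren (ext ρ) t) (ren ρ u)

weaken : ∀ {n} → Tm n → Tm (suc n)
weaken = ren suc

exts : ∀ {m n} → (Fin m → Tm n) → Fin (suc m) → Tm (suc n)
exts σ zero    = var zero
exts σ (suc i) = weaken (σ i)

sub : ∀ {m n} → (Fin m → Tm n) → Tm m → Tm n
sub σ (var i)   = σ i
sub σ (lam t)   = lam (sub (exts σ) t)
sub σ (app t u) = app (sub σ t) (sub σ u)
sub σ (jmp t u) = jmp (sub (exts σ) t) (sub σ u)

-- t{x/u} where x is the index 0 of t
single : ∀ {n} → Tm n → Fin (suc n) → Tm n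
single u zero    = u
single u (suc i) = var i

_⟪_⟫ : ∀ {n} → Tm (suc n) → Tm n → Tm n
t ⟪ u ⟫ = sub (single u) t

count : ∀ {n} → Fin n → Tm n → ℕ
count x (var y) with Data.Fin._≟_ x y
... | Relation.Nullary.yes _ = 1
... | Relation.Nullary.no  _ = 0
count x (lam t)   = count (suc x) t
count x (app t u) = count x t + count x u
count x (jmp t u) = count (suc x) t + count x u

-- identify index 1 (the fresh y) with index 0 (x): undoes the renaming t ↦ t_[y]_x
merge : ∀ {n} → Fin (suc (suc n)) → Fin (suc n)
merge zero          = zero
merge (suc zero)    = zero
merge (suc (suc i)) = suc i

-- For a term  t[x/u}  with x = index 0 of t.
-- (c): s is t_[y]_x[x/·][y/·] body: in s, index 0 = x (inner jump), index 1 = y (outer jump);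
--      merging y into x gives back t, and both x and y occur in s (1 ≤ i ≤ |t|_x - 1).
data Rw {n : ℕ} : Tm n → Tm n → Set where
  w : ∀ {t u} → count zero t ≡ 0 → Rw (jmp t u) (t ⟪ u ⟫)

data Rdc {n : ℕ} : Tm n → Tm n → Set where
  d : ∀ {t u} → count zero t ≡ 1 → Rdc (jmp t u) (t ⟪ u ⟫)
  c : ∀ {t u} (s : Tm (suc (suc n))) → 1 < count zero t →
      ren merge s ≡ t → 1 ≤ count zero s → 1 ≤ count (suc zero) s →
      Rdc (jmp t u) (jmp (jmp s (weaken u)) u)

data Rj {n : ℕ} : Tm n → Tm n → Set where
  rw  : ∀ {a b} → Rw a b  → Rj a b
  rdc : ∀ {a b} → Rdc a b → Rj a b

data Ctx (R : ∀ {n} → Tm n → Tm n → Set) : ∀ {n} → Tm n → Tm n → Set where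
  root  : ∀ {n} {a b : Tm n} → R a b → Ctx R a b
  lamC  : ∀ {n} {a b : Tm (suc n)} → Ctx R a b → Ctx R (lam a) (lam b)
  appL  : ∀ {n} {a b c : Tm n} → Ctx R a b → Ctx R (app a c) (app b c)
  appR  : ∀ {n} {a b c : Tm n} → Ctx R a b → Ctx R (app c a) (app c b)
  jmpL  : ∀ {n} {a b : Tm (suc n)} {c : Tm n} → Ctx R a b → Ctx R (jmp a c) (jmp b c)
  jmpR  : ∀ {n} {a b : Tm n} {c : Tm (suc n)} → Ctx R a b → Ctx R (jmp c a) (jmp c b)

_→j_ : ∀ {n} → Tm n → Tm n → Set
_→j_ = Ctx Rj

_→dc_ : ∀ {n} → Tm n → Tm n → Set
_→dc_ = Ctx Rdc

_→j⁺_ : ∀ {n} → Tm n → Tm n → Set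
_→j⁺_ = TransClosure _→j_

_→dc⁺_ : ∀ {n} → Tm n → Tm n → Set
_→dc⁺_ = TransClosure _→dc_

infix 8 _⟪_⟫
infix 4 _→j_ _→dc_ _→j⁺_ _→dc⁺_

-- By induction on |t|_x ≥ 1. If x occurs once, (d) applies. Otherwise (c) renames the
-- leftmost occurrence of x to a fresh y, giving t'[x/u][y/u] with |t'|_x = |t|_x - 1 and
-- |t'|_y = 1; the induction hypothesis reduces the inner jump to t'{x/u}[y/u], and a final
-- (d) step yields t'{x/u}{y/u} = t{x/u}, because merging y back into x turns t' into t.
-- If x does not occur, (w) applies.

module Submission where

open import Defs
open import Data.Nat using (ℕ; suc; _≤_)
open import Data.Fin using (zero)
open import Data.Product using (_×_)

open import Data.Nat using (zero; _+_; _<_; z≤n; s≤s)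
import Data.Nat.Properties as ℕ
open import Data.Fin using (Fin; suc; _≟_)
import Data.Fin.Properties as Fin
open import Data.Product using (_,_)
open import Function using (_∘_; id)
open import Function.Definitions using (Injective)
open import Relation.Nullary using (yes; no; contradiction)
open import Relation.Binary.PropositionalEquality
open import Relation.Binary.Construct.Closure.Transitive using (TransClosure; [_]; _∷_; _++_)

private
  variable
    m m′ m″ : ℕ

ext-comp : {ρ : Fin m′ → Fin m″} {ρ′ : Fin m → Fin m′} {ρ″ : Fin m → Fin m″} →
  (∀ j → ρ (ρ′ j) ≡ ρ″ j) → ∀ j → ext ρ (ext ρ′ j) ≡ ext ρ″ j
ext-comp h zero    = refl
ext-comp h (suc j) = cong suc (h j)

ext-injective : {ρ : Fin m → Fin m′} → Injective _≡_ _≡_ ρ → Injective _≡_ _≡_ (ext ρ)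
ext-injective inj {zero}  {zero}  _  = refl
ext-injective inj {suc i} {suc j} eq = cong suc (inj (Fin.suc-injective eq))

ext-avoids : {ρ : Fin m → Fin m′} {a : Fin m′} → (∀ j → ρ j ≢ a) → ∀ j → ext ρ j ≢ suc a
ext-avoids av (suc j) eq = av j (Fin.suc-injective eq)

ext-inverse : {μ : Fin m′ → Fin m} {ρ : Fin m → Fin m′} →
  (∀ j → μ (ρ j) ≡ j) → ∀ j → ext μ (ext ρ j) ≡ j
ext-inverse h zero    = refl
ext-inverse h (suc j) = cong suc (h j)

ren-ren : {ρ : Fin m′ → Fin m″} {ρ′ : Fin m → Fin m′} {ρ″ : Fin m → Fin m″} →
  (∀ j → ρ (ρ′ j) ≡ ρ″ j) → ∀ t → ren ρ (ren ρ′ t) ≡ ren ρ″ t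
ren-ren h (var j)   = cong var (h j)
ren-ren h (lam t)   = cong lam (ren-ren (ext-comp h) t)
ren-ren h (app t u) = cong₂ app (ren-ren h t) (ren-ren h u)
ren-ren h (jmp t u) = cong₂ jmp (ren-ren (ext-comp h) t) (ren-ren h u)

ren-inverse : {μ : Fin m′ → Fin m} {ρ : Fin m → Fin m′} →
  (∀ j → μ (ρ j) ≡ j) → ∀ t → ren μ (ren ρ t) ≡ t
ren-inverse h (var j)   = cong var (h j)
ren-inverse h (lam t)   = cong lam (ren-inverse (ext-inverse h) t)
ren-inverse h (app t u) = cong₂ app (ren-inverse h t) (ren-inverse h u)
ren-inverse h (jmp t u) = cong₂ jmp (ren-inverse (ext-inverse h) t) (ren-inverse h u)

ren-ext-weaken : (ρ : Fin m → Fin m′) (t : Tm m) → ren (ext ρ) (weaken t) ≡ weaken (ren ρ t)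
ren-ext-weaken ρ t = trans (ren-ren (λ _ → refl) t) (sym (ren-ren (λ _ → refl) t))

ren-exts : {ρ : Fin m′ → Fin m″} {σ : Fin m → Tm m′} {τ : Fin m → Tm m″} →
  (∀ j → ren ρ (σ j) ≡ τ j) → ∀ j → ren (ext ρ) (exts σ j) ≡ exts τ j
ren-exts h zero = refl
ren-exts {ρ = ρ} {σ} h (suc j) = trans (ren-ext-weaken ρ (σ j)) (cong weaken (h j))

ren-sub : {ρ : Fin m′ → Fin m″} {σ : Fin m → Tm m′} {τ : Fin m → Tm m″} →
  (∀ j → ren ρ (σ j) ≡ τ j) → ∀ t → ren ρ (sub σ t) ≡ sub τ t
ren-sub h (var j)   = h j
ren-sub h (lam t)   = cong lam (ren-sub (ren-exts h) t)
ren-sub h (app t u) = cong₂ app (ren-sub h t) (ren-sub h u)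
ren-sub h (jmp t u) = cong₂ jmp (ren-sub (ren-exts h) t) (ren-sub h u)

exts-ext : {σ : Fin m′ → Tm m″} {ρ : Fin m → Fin m′} {τ : Fin m → Tm m″} →
  (∀ j → σ (ρ j) ≡ τ j) → ∀ j → exts σ (ext ρ j) ≡ exts τ j
exts-ext h zero    = refl
exts-ext h (suc j) = cong weaken (h j)

sub-ren : {σ : Fin m′ → Tm m″} {ρ : Fin m → Fin m′} {τ : Fin m → Tm m″} →
  (∀ j → σ (ρ j) ≡ τ j) → ∀ t → sub σ (ren ρ t) ≡ sub τ t
sub-ren h (var j)   = h j
sub-ren h (lam t)   = cong lam (sub-ren (exts-ext h) t)
sub-ren h (app t u) = cong₂ app (sub-ren h t) (sub-ren h u)
sub-ren h (jmp t u) = cong₂ jmp (sub-ren (exts-ext h) t) (sub-ren h u)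

sub-exts-weaken : (σ : Fin m → Tm m′) (t : Tm m) → sub (exts σ) (weaken t) ≡ weaken (sub σ t)
sub-exts-weaken σ t = trans (sub-ren (λ _ → refl) t) (sym (ren-sub (λ _ → refl) t))

exts-sub : {σ : Fin m′ → Tm m″} {σ′ : Fin m → Tm m′} {τ : Fin m → Tm m″} →
  (∀ j → sub σ (σ′ j) ≡ τ j) → ∀ j → sub (exts σ) (exts σ′ j) ≡ exts τ j
exts-sub h zero = refl
exts-sub {σ = σ} {σ′} h (suc j) = trans (sub-exts-weaken σ (σ′ j)) (cong weaken (h j))

sub-sub : {σ : Fin m′ → Tm m″} {σ′ : Fin m → Tm m′} {τ : Fin m → Tm m″} →
  (∀ j → sub σ (σ′ j) ≡ τ j) → ∀ t → sub σ (sub σ′ t) ≡ sub τ t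
sub-sub h (var j)   = h j
sub-sub h (lam t)   = cong lam (sub-sub (exts-sub h) t)
sub-sub h (app t u) = cong₂ app (sub-sub h t) (sub-sub h u)
sub-sub h (jmp t u) = cong₂ jmp (sub-sub (exts-sub h) t) (sub-sub h u)

exts-var : {σ : Fin m → Tm m} → (∀ j → σ j ≡ var j) → ∀ j → exts σ j ≡ var j
exts-var h zero    = refl
exts-var h (suc j) = cong weaken (h j)

sub-var : {σ : Fin m → Tm m} → (∀ j → σ j ≡ var j) → ∀ t → sub σ t ≡ t
sub-var h (var j)   = h j
sub-var h (lam t)   = cong lam (sub-var (exts-var h) t)
sub-var h (app t u) = cong₂ app (sub-var h t) (sub-var h u)
sub-var h (jmp t u) = cong₂ jmp (sub-var (exts-var h) t) (sub-var h u)

weaken-⟪⟫ : ∀ {n} (t u : Tm n) → weaken t ⟪ u ⟫ ≡ t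
weaken-⟪⟫ t u = trans (sub-ren (λ _ → refl) t) (sub-var (λ _ → refl) t)

⟪weaken⟫⟪⟫ : ∀ {n} (s : Tm (suc (suc n))) (u : Tm n) → s ⟪ weaken u ⟫ ⟪ u ⟫ ≡ ren merge s ⟪ u ⟫
⟪weaken⟫⟪⟫ s u = trans (sub-sub single-merge s) (sym (sub-ren (λ _ → refl) s))
  where
  single-merge : ∀ j → sub (single u) (single (weaken u) j) ≡ single u (merge j)
  single-merge zero          = weaken-⟪⟫ u u
  single-merge (suc zero)    = refl
  single-merge (suc (suc j)) = refl

n≡1+k⇒1≤n : ∀ {n k} → n ≡ suc k → 1 ≤ n
n≡1+k⇒1≤n refl = s≤s z≤n

count-var-self : (a : Fin m) → count a (var a) ≡ 1
count-var-self a with a ≟ a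
... | yes _   = refl
... | no  a≢a = contradiction refl a≢a

count-var-≢ : {a b : Fin m} → a ≢ b → count a (var b) ≡ 0
count-var-≢ {a = a} {b} a≢b with a ≟ b
... | yes a≡b = contradiction a≡b a≢b
... | no _    = refl

count-ren-injective : {ρ : Fin m → Fin m′} → Injective _≡_ _≡_ ρ →
  ∀ a t → count (ρ a) (ren ρ t) ≡ count a t
count-ren-injective {ρ = ρ} inj a (var j) with a ≟ j
... | yes refl = count-var-self (ρ a)
... | no a≢j   = count-var-≢ (a≢j ∘ inj)
count-ren-injective inj a (lam t)   = count-ren-injective (ext-injective inj) (suc a) t
count-ren-injective inj a (app t u) =
  cong₂ _+_ (count-ren-injective inj a t) (count-ren-injective inj a u)
count-ren-injective inj a (jmp t u) =
  cong₂ _+_ (count-ren-injective (ext-injective inj) (suc a) t) (count-ren-injective inj a u)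

count-weaken : (a : Fin m) (t : Tm m) → count (suc a) (weaken t) ≡ count a t
count-weaken = count-ren-injective Fin.suc-injective

count-ren-avoiding : {ρ : Fin m → Fin m′} {a : Fin m′} → (∀ j → ρ j ≢ a) →
  ∀ t → count a (ren ρ t) ≡ 0
count-ren-avoiding av (var j)   = count-var-≢ (av j ∘ sym)
count-ren-avoiding av (lam t)   = count-ren-avoiding (ext-avoids av) t
count-ren-avoiding av (app t u) = cong₂ _+_ (count-ren-avoiding av t) (count-ren-avoiding av u)
count-ren-avoiding av (jmp t u) =
  cong₂ _+_ (count-ren-avoiding (ext-avoids av) t) (count-ren-avoiding av u)

count-exts : {σ : Fin m → Tm m′} {a : Fin m′} {b : Fin m} →
  (∀ j → count a (σ j) ≡ count b (var j)) → ∀ j → count (suc a) (exts σ j) ≡ count (suc b) (var j)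
count-exts h zero = refl
count-exts {σ = σ} {a} {b} h (suc j) =
  trans (count-weaken a (σ j)) (trans (h j) (sym (count-weaken b (var j))))

count-sub : {σ : Fin m → Tm m′} {a : Fin m′} {b : Fin m} →
  (∀ j → count a (σ j) ≡ count b (var j)) → ∀ t → count a (sub σ t) ≡ count b t
count-sub h (var j)   = h j
count-sub h (lam t)   = count-sub (count-exts h) t
count-sub h (app t u) = cong₂ _+_ (count-sub h t) (count-sub h u)
count-sub h (jmp t u) = cong₂ _+_ (count-sub (count-exts h) t) (count-sub h u)

count-⟪weaken⟫ : ∀ {n} (s : Tm (suc (suc n))) (u : Tm n) →
  count zero (s ⟪ weaken u ⟫) ≡ count (suc zero) s
count-⟪weaken⟫ s u = count-sub single-weaken s
  where
  single-weaken : ∀ j → count zero (single (weaken u) j) ≡ count (suc zero) (var j)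
  single-weaken zero    = count-ren-avoiding (λ _ ()) u
  single-weaken (suc j) = sym (count-weaken zero (var j))

-- The term t_[y]_x of rule (c) for the leftmost occurrence of x; ρ relocates all other variables.
renameLeftmost : Fin m → Fin m′ → (Fin m → Fin m′) → Tm m → Tm m′
renameLeftmost x y ρ (var j) with x ≟ j
... | yes _ = var y
... | no _  = var (ρ j)
renameLeftmost x y ρ (lam t) = lam (renameLeftmost (suc x) (suc y) (ext ρ) t)
renameLeftmost x y ρ (app t u) with count x t
... | zero  = app (ren ρ t) (renameLeftmost x y ρ u)
... | suc _ = app (renameLeftmost x y ρ t) (ren ρ u)
renameLeftmost x y ρ (jmp t u) with count (suc x) t
... | zero  = jmp (ren (ext ρ) t) (renameLeftmost x y ρ u)
... | suc _ = jmp (renameLeftmost (suc x) (suc y) (ext ρ) t) (ren ρ u)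

ren-renameLeftmost : {x : Fin m} {y : Fin m′} {ρ : Fin m → Fin m′} {μ : Fin m′ → Fin m} →
  (∀ j → μ (ρ j) ≡ j) → μ y ≡ x → ∀ t → ren μ (renameLeftmost x y ρ t) ≡ t
ren-renameLeftmost {x = x} inv μy (var j) with x ≟ j
... | yes refl = cong var μy
... | no _     = cong var (inv j)
ren-renameLeftmost inv μy (lam t) =
  cong lam (ren-renameLeftmost (ext-inverse inv) (cong suc μy) t)
ren-renameLeftmost {x = x} inv μy (app t u) with count x t
... | zero  = cong₂ app (ren-inverse inv t) (ren-renameLeftmost inv μy u)
... | suc _ = cong₂ app (ren-renameLeftmost inv μy t) (ren-inverse inv u)
ren-renameLeftmost {x = x} inv μy (jmp t u) with count (suc x) t
... | zero  = cong₂ jmp (ren-inverse (ext-inverse inv) t) (ren-renameLeftmost inv μy u)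
... | suc _ = cong₂ jmp (ren-renameLeftmost (ext-inverse inv) (cong suc μy) t) (ren-inverse inv u)

count-renameLeftmost-target : {x : Fin m} {y : Fin m′} {ρ : Fin m → Fin m′} →
  (∀ j → ρ j ≢ y) → ∀ t → 1 ≤ count x t → count y (renameLeftmost x y ρ t) ≡ 1
count-renameLeftmost-target {x = x} av (var j) h with x ≟ j
count-renameLeftmost-target {y = y} av (var j) h  | yes _ = count-var-self y
count-renameLeftmost-target         av (var j) () | no _
count-renameLeftmost-target av (lam t) h = count-renameLeftmost-target (ext-avoids av) t h
count-renameLeftmost-target {x = x} av (app t u) h with count x t in eq
... | zero  = cong₂ _+_ (count-ren-avoiding av t) (count-renameLeftmost-target av u h)
... | suc _ = cong₂ _+_ (count-renameLeftmost-target av t (n≡1+k⇒1≤n eq)) (count-ren-avoiding av u)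
count-renameLeftmost-target {x = x} av (jmp t u) h with count (suc x) t in eq
... | zero  = cong₂ _+_ (count-ren-avoiding (ext-avoids av) t) (count-renameLeftmost-target av u h)
... | suc _ = cong₂ _+_ (count-renameLeftmost-target (ext-avoids av) t (n≡1+k⇒1≤n eq))
                        (count-ren-avoiding av u)

count-renameLeftmost-source : {x : Fin m} {y : Fin m′} {ρ : Fin m → Fin m′} →
  Injective _≡_ _≡_ ρ → (∀ j → ρ j ≢ y) →
  ∀ t → 1 ≤ count x t → suc (count (ρ x) (renameLeftmost x y ρ t)) ≡ count x t
count-renameLeftmost-source {x = x} inj av (var j) h with x ≟ j
count-renameLeftmost-source {x = x} inj av (var j) h  | yes refl = cong suc (count-var-≢ (av x))
count-renameLeftmost-source         inj av (var j) () | no _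
count-renameLeftmost-source inj av (lam t) h =
  count-renameLeftmost-source (ext-injective inj) (ext-avoids av) t h
count-renameLeftmost-source {x = x} inj av (app t u) h with count x t in eq
... | zero  = trans (cong suc (cong (_+ _) (trans (count-ren-injective inj x t) eq)))
                    (count-renameLeftmost-source inj av u h)
... | suc _ = cong₂ _+_ (trans (count-renameLeftmost-source inj av t (n≡1+k⇒1≤n eq)) eq)
                        (count-ren-injective inj x u)
count-renameLeftmost-source {x = x} inj av (jmp t u) h with count (suc x) t in eq
... | zero  = trans (cong suc (cong (_+ _) (trans (count-ren-injective (ext-injective inj) (suc x) t)
                                                          eq)))
                    (count-renameLeftmost-source inj av u h)
... | suc _ = cong₂ _+_ (trans (count-renameLeftmost-source (ext-injective inj) (ext-avoids av) t
                                                             (n≡1+k⇒1≤n eq)) eq)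
                        (count-ren-injective inj x u)

map⁺ : {A B : Set} {R : A → A → Set} {S : B → B → Set} (f : A → B) →
  (∀ {a b} → R a b → S (f a) (f b)) → ∀ {a b} → TransClosure R a b → TransClosure S (f a) (f b)
map⁺ f g [ r ]    = [ g r ]
map⁺ f g (r ∷ rs) = g r ∷ map⁺ f g rs

Ctx-map : {R S : ∀ {n} → Tm n → Tm n → Set} → (∀ {n} {a b : Tm n} → R a b → S a b) →
  ∀ {n} {a b : Tm n} → Ctx R a b → Ctx S a b
Ctx-map g (root r) = root (g r)
Ctx-map g (lamC r) = lamC (Ctx-map g r)
Ctx-map g (appL r) = appL (Ctx-map g r)
Ctx-map g (appR r) = appR (Ctx-map g r)
Ctx-map g (jmpL r) = jmpL (Ctx-map g r)
Ctx-map g (jmpR r) = jmpR (Ctx-map g r)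

→dc⁺⇒→j⁺ : ∀ {n} {a b : Tm n} → a →dc⁺ b → a →j⁺ b
→dc⁺⇒→j⁺ = map⁺ id (Ctx-map rdc)

jmp-→dc⁺-⟪⟫ : ∀ k {n} (t : Tm (suc n)) (u : Tm n) → count zero t ≡ suc k → jmp t u →dc⁺ t ⟪ u ⟫
jmp-→dc⁺-⟪⟫ zero    t u |t| = [ root (d |t|) ]
jmp-→dc⁺-⟪⟫ (suc k) {n} t u |t| =
  subst (jmp t u →dc⁺_) s⟪u⟫⟪u⟫≡t⟪u⟫
    (root (c s (subst (1 <_) (sym |t|) (s≤s (s≤s z≤n))) s-merges
             (n≡1+k⇒1≤n |s|ₓ) (n≡1+k⇒1≤n |s|ᵧ))
     ∷ map⁺ (λ a → jmp a u) jmpL (jmp-→dc⁺-⟪⟫ k s (weaken u) |s|ₓ)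
     ++ [ root (d (trans (count-⟪weaken⟫ s u) |s|ᵧ)) ])
  where
  s : Tm (suc (suc n))
  s = renameLeftmost zero (suc zero) (ext suc) t

  merge-ext-suc : ∀ j → merge (ext suc j) ≡ j
  merge-ext-suc zero    = refl
  merge-ext-suc (suc j) = refl

  s-merges : ren merge s ≡ t
  s-merges = ren-renameLeftmost merge-ext-suc refl t

  |s|ᵧ : count (suc zero) s ≡ 1
  |s|ᵧ = count-renameLeftmost-target (ext-avoids (λ _ ())) t (n≡1+k⇒1≤n |t|)

  |s|ₓ : count zero s ≡ suc k
  |s|ₓ = ℕ.suc-injective (trans (count-renameLeftmost-source (ext-injective Fin.suc-injective)
                                   (ext-avoids (λ _ ())) t (n≡1+k⇒1≤n |t|)) |t|)

  s⟪u⟫⟪u⟫≡t⟪u⟫ : s ⟪ weaken u ⟫ ⟪ u ⟫ ≡ t ⟪ u ⟫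
  s⟪u⟫⟪u⟫≡t⟪u⟫ = trans (⟪weaken⟫⟪⟫ s u) (cong _⟪ u ⟫ s-merges)

lemma2p2 : ∀ {n} (t : Tm (suc n)) (u : Tm n) →
    (jmp t u →j⁺ t ⟪ u ⟫) × (1 ≤ count zero t → jmp t u →dc⁺ t ⟪ u ⟫)
lemma2p2 t u with count zero t in |t|
... | zero  = [ root (rw (w |t|)) ] , λ ()
... | suc k = →dc⁺⇒→j⁺ (jmp-→dc⁺-⟪⟫ k t u |t|) , λ _ → jmp-→dc⁺-⟪⟫ k t u |t|
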